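{- For all $(x_1,x_2)\in\mathbb{N}^2$, we have $x_2=x_1!$ if and only if there exists $(y_1,\dots,y_{13})\in\mathbb{N}^{13}$ such that \[ (y_1-x_1^2)^2+(y_2-2^{3y_1})^2+(y_3-x_1y_1)^2+B(y_2,x_1,y_5,y_6,\dots,y_{11},y_4)+E_/(2^{3y_3},y_4,y_{12},y_{13},x_2)=0 . \]
   Context: $\mathbb{N}$ includes $0$ and $0!=1$. For integers $a,b,c,d,e$ define $E_/(a,b,c,d,e)=(a-be-c)^2+(c+d+1-b)^2$ and $E_{\bmod}(a,b,c,d,e)=(a-bc-e)^2+(e+d+1-b)^2$. For integers $a,b,z_1,\dots,z_7,c$ define \[ B(a,b,z_1,\dots,z_7,c)=\big(z_1-(2a^3+8a^2+2ab+12a+4b+8)\big)^2+\big(z_2-(2a^2+8a+8)\big)^2+E_/\big(2^{z_1},2^{z_2}-2^{2a+4}-1,z_4,z_5,z_3\big)+E_{\bmod}\big(z_3,2^{2a+4},z_6,z_7,c\big). \] -}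

module Defs where

open import Data.Nat as ℕ using (ℕ)
open import Data.Integer using (ℤ; +_; _+_; _-_; _*_)

sq : ℤ → ℤ
sq x = x * x

pow2 : ℕ → ℤ
pow2 n = + (2 ℕ.^ n)

E/ : ℤ → ℤ → ℤ → ℤ → ℤ → ℤ
E/ a b c d e = sq (a - b * e - c) + sq (c + d + + 1 - b)

Emod : ℤ → ℤ → ℤ → ℤ → ℤ → ℤ
Emod a b c d e = sq (a - b * c - e) + sq (e + d + + 1 - b)

-- B(a,b,z1,...,z7,c); arguments natural (exponents of 2 must be natural),
-- arithmetic carried out in ℤ.
B : ℕ → ℕ → ℕ → ℕ → ℕ → ℕ → ℕ → ℕ → ℕ → ℕ → ℤ
B a b z1 z2 z3 z4 z5 z6 z7 c =
    sq (+ z1 - (+ 2 * A * A * A + + 8 * A * A + + 2 * A * Bz + + 12 * A + + 4 * Bz + + 8))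
  + sq (+ z2 - (+ 2 * A * A + + 8 * A + + 8))
  + E/ (pow2 z1) (pow2 z2 - pow2 (2 ℕ.* a ℕ.+ 4) - + 1) (+ z4) (+ z5) (+ z3)
  + Emod (+ z3) (pow2 (2 ℕ.* a ℕ.+ 4)) (+ z6) (+ z7) (+ c)
  where
    A  = + a
    Bz = + b

{-# OPTIONS --safe #-}
module Submission where

-- A sum of squares vanishes iff every square does, and E_/ and E_mod vanish exactly on
-- quotient-remainder pairs. With r = 2^(3x²) the equation therefore says y₄ = C(r, x) and
-- x₂ = ⌊r^x / C(r, x)⌋. Since C(r, x) · x! = r(r-1)⋯(r-x+1) and
-- r^x - r(r-1)⋯(r-x+1) ≤ x² r^(x-1) < C(r, x) as soon as (x! + 1) x² < r, that quotient is x!.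
--
-- B reads off a binomial coefficient. Let v = 2^(2a+4) and D = v^(a+2) - v - 1, so that
-- 2^z₁ = (D + v + 1)^a v^(b+2) ≡ (1 + v)^a v^(b+2) (mod D). The base-v digits of (1 + v)^a
-- are the C(a, j) < v/2; splitting them at j = a - b and reducing v^(a+2) ≡ v + 1 (mod D)
-- carries the high digits into the quotient and leaves a remainder below D, so the last
-- base-v digit of the quotient, which E_mod extracts, is C(a, a - b) = C(a, b).

module ℕ-Arithmetic where

  open import Data.Bool.Base using (true)
  open import Data.Nat
  open import Data.Nat.Properties
  open import Data.Nat.Combinatorics
  open import Data.Nat.Combinatorics.Base using (_P′_)
  open import Data.Nat.Combinatorics.Specification using (k!∣nP′k)
  open import Data.Nat.DivMod using (m/n*n≡m)
  open import Data.Nat.Tactic.RingSolver using (solve-∀)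
  open import Data.Product using (∃-syntax; _×_; _,_; proj₁; proj₂)
  open import Function.Base using (_∘_)
  open import Relation.Binary.Definitions using (tri<; tri≈; tri>)
  open import Relation.Binary.PropositionalEquality
  open import Relation.Nullary.Negation using (contradiction)

  d*q+r<d*q′+r′ : ∀ d {q r q′ r′} → r < d → q < q′ → d * q + r < d * q′ + r′
  d*q+r<d*q′+r′ d {q} {r} {q′} {r′} r<d q<q′ = begin-strict
    d * q + r    <⟨ +-monoʳ-< (d * q) r<d ⟩
    d * q + d    ≡⟨ +-comm (d * q) d ⟩
    d + d * q    ≡⟨ *-suc d q ⟨
    d * suc q    ≤⟨ *-monoʳ-≤ d q<q′ ⟩
    d * q′       ≤⟨ m≤m+n (d * q′) r′ ⟩
    d * q′ + r′  ∎
    where open ≤-Reasoning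

  divMod-unique : ∀ {d q r q′ r′} → r < d → r′ < d →
                  d * q + r ≡ d * q′ + r′ → q ≡ q′ × r ≡ r′
  divMod-unique {d} {q} {r} {q′} {r′} r<d r′<d eq with <-cmp q q′
  ... | tri< q<q′ _ _ = contradiction eq (<⇒≢ (d*q+r<d*q′+r′ d r<d q<q′))
  ... | tri> _ _ q′<q = contradiction (sym eq) (<⇒≢ (d*q+r<d*q′+r′ d r′<d q′<q))
  ... | tri≈ _ refl _ = refl , +-cancelˡ-≡ (d * q) r r′ eq

  -- Base-v numerals and binomial coefficients

  -- numeral v f n = Σ_{i<n} f i · vⁱ; the digits f i may exceed v.
  numeral : ℕ → (ℕ → ℕ) → ℕ → ℕ
  numeral v f zero    = 0
  numeral v f (suc n) = f 0 + v * numeral v (f ∘ suc) n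

  numeral-cong : ∀ v {f g} n → (∀ i → f i ≡ g i) → numeral v f n ≡ numeral v g n
  numeral-cong v zero    f≗g = refl
  numeral-cong v (suc n) f≗g =
    cong₂ (λ d x → d + v * x) (f≗g 0) (numeral-cong v n (f≗g ∘ suc))

  numeral-+ : ∀ v f g n → numeral v (λ i → f i + g i) n ≡ numeral v f n + numeral v g n
  numeral-+ v f g zero    = refl
  numeral-+ v f g (suc n) rewrite numeral-+ v (f ∘ suc) (g ∘ suc) n =
    lemma (f 0) (g 0) v (numeral v (f ∘ suc) n) (numeral v (g ∘ suc) n)
    where
    lemma : ∀ a b v x y → a + b + v * (x + y) ≡ a + v * x + (b + v * y)
    lemma = solve-∀

  numeral-zeros : ∀ v n → numeral v (λ _ → 0) n ≡ 0
  numeral-zeros v zero    = refl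
  numeral-zeros v (suc n) rewrite numeral-zeros v n = *-zeroʳ v

  numeral-split : ∀ v f m n →
                  numeral v f (m + n) ≡ numeral v f m + v ^ m * numeral v (f ∘ (m +_)) n
  numeral-split v f zero    n = sym (+-identityʳ (numeral v f n))
  numeral-split v f (suc m) n rewrite numeral-split v (f ∘ suc) m n =
    lemma (f 0) v (numeral v (f ∘ suc) m) (v ^ m) (numeral v (f ∘ (suc m +_)) n)
    where
    lemma : ∀ a v x p y → a + v * (x + p * y) ≡ a + v * x + v * p * y
    lemma = solve-∀

  numeral-bound : ∀ {v} f n → (∀ i → 2 * f i < v) → 2 * numeral v f n < v ^ n
  numeral-bound     f zero    digits = s≤s z≤n
  numeral-bound {v} f (suc n) digits = begin-strict
    2 * (f 0 + v * x)      ≡⟨ lemma (f 0) v x ⟩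
    2 * f 0 + v * (2 * x)  <⟨ +-monoˡ-< (v * (2 * x)) (digits 0) ⟩
    v + v * (2 * x)        ≡⟨ *-suc v (2 * x) ⟨
    v * suc (2 * x)        ≤⟨ *-monoʳ-≤ v (numeral-bound (f ∘ suc) n (digits ∘ suc)) ⟩
    v * v ^ n              ∎
    where
    open ≤-Reasoning
    x : ℕ
    x = numeral v (f ∘ suc) n
    lemma : ∀ a v x → 2 * (a + v * x) ≡ 2 * a + v * (2 * x)
    lemma = solve-∀

  binomial-theorem : ∀ v a n → a < n → (1 + v) ^ a ≡ numeral v (a C_) n
  binomial-theorem v zero    (suc n) _ =
    cong suc (sym (trans (cong (v *_) (numeral-zeros v n)) (*-zeroʳ v)))
  binomial-theorem v (suc a) (suc n) (s≤s a<n) = begin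
    (1 + v) * x             ≡⟨ lemma₁ v x ⟩
    x + v * x               ≡⟨ cong₂ (λ y z → y + v * z) x≡1+v*high x≡low ⟩
    1 + v * high + v * low  ≡⟨ lemma₂ v high low ⟩
    1 + v * (low + high)
      ≡⟨ cong (λ y → 1 + v * y) (numeral-+ v (a C_) (λ i → a C suc i) n) ⟨
    1 + v * numeral v (λ i → a C i + a C suc i) n
      ≡⟨ cong (λ y → 1 + v * y) (numeral-cong v n (nCk+nC[k+1]≡[n+1]C[k+1] a)) ⟩
    numeral v (suc a C_) (suc n) ∎
    where
    open ≡-Reasoning
    x low high : ℕ
    x = (1 + v) ^ a
    low = numeral v (a C_) n
    high = numeral v (λ i → a C suc i) n
    x≡1+v*high : x ≡ 1 + v * high
    x≡1+v*high = binomial-theorem v a (suc n) (m<n⇒m<1+n a<n)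
    x≡low : x ≡ low
    x≡low = binomial-theorem v a n a<n
    lemma₁ : ∀ v x → (1 + v) * x ≡ x + v * x
    lemma₁ = solve-∀
    lemma₂ : ∀ v h l → 1 + v * h + v * l ≡ 1 + v * (l + h)
    lemma₂ = solve-∀

  pow-mod : ∀ d e n → ∃[ s ] (d + e) ^ n ≡ d * s + e ^ n
  pow-mod d e zero    = 0 , cong (_+ 1) (sym (*-zeroʳ d))
  pow-mod d e (suc n) with pow-mod d e n
  ... | s , eq = (d + e) * s + e ^ n , trans (cong ((d + e) *_) eq) (lemma d e s (e ^ n))
    where
    lemma : ∀ d e s x → (d + e) * (d * s + x) ≡ d * ((d + e) * s + x) + e * x
    lemma = solve-∀

  [1+u]*[1+v]<2*[u*v] : ∀ {u v} → 2 < u → 2 < v → suc u * suc v < 2 * (u * v)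
  [1+u]*[1+v]<2*[u*v] {suc (suc (suc p))} {suc (suc (suc q))}
                      (s≤s (s≤s (s≤s _))) (s≤s (s≤s (s≤s _))) =
    ≤-trans (m<m+n _ {2 + 2 * p + 2 * q + p * q} (s≤s z≤n)) (≤-reflexive (lemma p q))
    where
    lemma : ∀ p q → (4 + p) * (4 + q) + (2 + 2 * p + 2 * q + p * q) ≡ 2 * ((3 + p) * (3 + q))
    lemma = solve-∀

  numeral-digit : ∀ {v D} f m b s → 2 < v → (∀ i → 2 * f i < v) →
                  D + suc v ≡ v ^ m * v ^ (2 + b) →
                  ∃[ q ] ∃[ r ] (D * s + numeral v f (m + suc b)) * v ^ (2 + b) ≡ D * (v * q + f m) + r
                                × r < D
  numeral-digit {v} {D} f m b s 2<v digits D+1+v≡ =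
    s * u + high′ , low * w + high * suc v , division , remainder<D
    where
    instance
      v≢0 : NonZero v
      v≢0 = >-nonZero (≤-trans (s≤s z≤n) 2<v)
    u w low high high′ : ℕ
    u = v ^ suc b
    w = v ^ (2 + b)
    low = numeral v f m
    high = numeral v (f ∘ (m +_)) (suc b)
    high′ = numeral v (λ i → f (m + suc i)) b
    division : (D * s + numeral v f (m + suc b)) * w
             ≡ D * (v * (s * u + high′) + f m) + (low * w + high * suc v)
    division = begin
      (D * s + numeral v f (m + suc b)) * w
        ≡⟨ cong (λ x → (D * s + x) * w) (numeral-split v f m (suc b)) ⟩
      (D * s + (low + v ^ m * high)) * w
        ≡⟨ lemma₁ D s low (v ^ m) high w ⟩
      D * (s * w) + low * w + high * (v ^ m * w)
        ≡⟨ cong (λ y → D * (s * w) + low * w + high * y) D+1+v≡ ⟨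
      D * (s * w) + low * w + high * (D + suc v)
        ≡⟨ lemma₂ D s v u (f (m + 0)) high′ low ⟩
      D * (v * (s * u + high′) + f (m + 0)) + (low * w + high * suc v)
        ≡⟨ cong (λ i → D * (v * (s * u + high′) + f i) + (low * w + high * suc v)) (+-identityʳ m) ⟩
      D * (v * (s * u + high′) + f m) + (low * w + high * suc v) ∎
      where
      open ≡-Reasoning
      lemma₁ : ∀ D s l p h w → (D * s + (l + p * h)) * w ≡ D * (s * w) + l * w + h * (p * w)
      lemma₁ = solve-∀
      lemma₂ : ∀ D s v u c h′ l → D * (s * (v * u)) + l * (v * u) + (c + v * h′) * (D + suc v)
                                ≡ D * (v * (s * u + h′) + c) + (l * (v * u) + (c + v * h′) * suc v)
      lemma₂ = solve-∀
    carry< : suc high * suc v < w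
    carry< = *-cancelˡ-< 2 _ _ (begin-strict
      2 * (suc high * suc v)  ≡⟨ *-assoc 2 (suc high) (suc v) ⟨
      2 * suc high * suc v    ≡⟨ cong (_* suc v) (*-suc 2 high) ⟩
      (2 + 2 * high) * suc v
        ≤⟨ *-monoˡ-≤ (suc v) (s≤s (numeral-bound (f ∘ (m +_)) (suc b) (digits ∘ (m +_)))) ⟩
      suc u * suc v
        <⟨ [1+u]*[1+v]<2*[u*v] (≤-trans 2<v (m≤m*n v (v ^ b) {{m^n≢0 v b}})) 2<v ⟩
      2 * (u * v)             ≡⟨ cong (2 *_) (*-comm u v) ⟩
      2 * w                   ∎)
      where open ≤-Reasoning
    remainder<D : low * w + high * suc v < D
    remainder<D = +-cancelʳ-< (suc v) _ D (begin-strict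
      low * w + high * suc v + suc v  ≡⟨ lemma low w high v ⟩
      low * w + suc high * suc v      <⟨ +-monoʳ-< (low * w) carry< ⟩
      low * w + w                     ≡⟨ +-comm (low * w) w ⟩
      suc low * w
        ≤⟨ *-monoˡ-≤ w (≤-trans (s≤s (m≤m+n low (low + 0))) (numeral-bound f m digits)) ⟩
      v ^ m * w                       ≡⟨ D+1+v≡ ⟨
      D + suc v                       ∎)
      where
      open ≤-Reasoning
      lemma : ∀ l w h v → l * w + h * suc v + suc v ≡ l * w + suc h * suc v
      lemma = solve-∀

  binomial-digit : ∀ {v D a b} → b ≤ a → (∀ j → 2 * (a C j) < v) → D + suc v ≡ v ^ (2 + a) →
                   ∃[ q ] ∃[ r ] (D + suc v) ^ a * v ^ (2 + b) ≡ D * (v * q + a C b) + r × r < D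
  binomial-digit {v} {D} {a} {b} b≤a digits D+1+v≡ with m≤n⇒∃[o]m+o≡n b≤a
  ... | m , refl with pow-mod D (suc v) (b + m)
  ... | s , mod-D with numeral-digit {v} ((b + m) C_) m b s (digits 0) digits D+1+v≡′
    where
    D+1+v≡′ : D + suc v ≡ v ^ m * v ^ (2 + b)
    D+1+v≡′ = trans D+1+v≡ (trans (cong (v ^_) (lemma b m)) (^-distribˡ-+-* v m (2 + b)))
      where
      lemma : ∀ b m → 2 + (b + m) ≡ m + (2 + b)
      lemma = solve-∀
  ... | q , r , division , r<D = q , r , (begin
    (D + suc v) ^ (b + m) * v ^ (2 + b)
      ≡⟨ cong (_* v ^ (2 + b)) mod-D ⟩
    (D * s + (1 + v) ^ (b + m)) * v ^ (2 + b)
      ≡⟨ cong (λ x → (D * s + x) * v ^ (2 + b)) (binomial-theorem v (b + m) (m + suc b) b+m<m+1+b) ⟩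
    (D * s + numeral v ((b + m) C_) (m + suc b)) * v ^ (2 + b)
      ≡⟨ division ⟩
    D * (v * q + (b + m) C m) + r
      ≡⟨ cong (λ c → D * (v * q + c) + r) symmetry ⟨
    D * (v * q + (b + m) C b) + r ∎) , r<D
    where
    open ≡-Reasoning
    b+m<m+1+b : b + m < m + suc b
    b+m<m+1+b = ≤-reflexive (trans (cong suc (+-comm b m)) (sym (+-suc m b)))
    symmetry : (b + m) C b ≡ (b + m) C m
    symmetry = trans (nCk≡nC[n∸k] (m≤m+n b m)) (cong ((b + m) C_) (m+n∸m≡n b m))

  binomial-digit-unique : ∀ {v D a b q c r} → b ≤ a → (∀ j → 2 * (a C j) < v) →
                          D + suc v ≡ v ^ (2 + a) →
                          (D + suc v) ^ a * v ^ (2 + b) ≡ D * (v * q + c) + r → r < D → c < v →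
                          c ≡ a C b
  binomial-digit-unique {a = a} {b} b≤a digits D+1+v≡ division r<D c<v
    with binomial-digit b≤a digits D+1+v≡
  ... | q′ , r′ , division′ , r′<D
    with divMod-unique r<D r′<D (trans (sym division) division′)
  ... | vq+c≡vq′+aCb , _ =
    proj₂ (divMod-unique c<v (≤-<-trans (m≤m+n (a C b) (a C b + 0)) (digits b)) vq+c≡vq′+aCb)

  -- The factorial as a quotient

  nP′k≤n^k : ∀ n k → n P′ k ≤ n ^ k
  nP′k≤n^k n zero    = ≤-refl
  nP′k≤n^k n (suc k) = *-mono-≤ (m∸n≤m n k) (nP′k≤n^k n k)

  nCk*k!≡nP′k : ∀ {n k} → k ≤ n → (n C k) * k ! ≡ n P′ k
  nCk*k!≡nP′k {n} {k} k≤n = begin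
    (n C k) * k !         ≡⟨ cong (_* k !) (nCk≡nPk/k! k≤n) ⟩
    (n P k) / k ! * k !   ≡⟨ cong (λ p → p / k ! * k !) nPk≡nP′k ⟩
    (n P′ k) / k ! * k !  ≡⟨ m/n*n≡m (k!∣nP′k k≤n) ⟩
    n P′ k                ∎
    where
    open ≡-Reasoning
    instance _ = k !≢0
    nPk≡nP′k : n P k ≡ n P′ k
    nPk≡nP′k with k ≤ᵇ n | ≤⇒≤ᵇ k≤n
    ... | true | _ = refl

  n*n^k≤n*nP′k+k*k*n^k : ∀ {n} k → k ≤ n → n * n ^ k ≤ n * (n P′ k) + k * k * n ^ k
  n*n^k≤n*nP′k+k*k*n^k {n} zero    _     = m≤m+n (n * 1) 0
  n*n^k≤n*nP′k+k*k*n^k {n} (suc k) 1+k≤n = begin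
    n * (n * e)
      ≤⟨ *-monoʳ-≤ n (n*n^k≤n*nP′k+k*k*n^k k k≤n) ⟩
    n * (n * p + k * k * e)
      ≡⟨ cong (λ m → n * (m * p + k * k * e)) (m∸n+n≡m k≤n) ⟨
    n * ((n ∸ k + k) * p + k * k * e)
      ≡⟨ lemma₁ n (n ∸ k) k p e ⟩
    n * ((n ∸ k) * p) + k * (n * p) + k * k * (n * e)
      ≤⟨ +-monoˡ-≤ (k * k * (n * e)) (+-monoʳ-≤ (n * ((n ∸ k) * p)) (*-monoʳ-≤ k p≤e)) ⟩
    n * ((n ∸ k) * p) + k * (n * e) + k * k * (n * e)
      ≤⟨ m≤m+n _ (suc k * (n * e)) ⟩
    n * ((n ∸ k) * p) + k * (n * e) + k * k * (n * e) + suc k * (n * e)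
      ≡⟨ lemma₂ (n * ((n ∸ k) * p)) k (n * e) ⟩
    n * ((n ∸ k) * p) + suc k * suc k * (n * e)    ∎
    where
    open ≤-Reasoning
    k≤n : k ≤ n
    k≤n = ≤-trans (n≤1+n k) 1+k≤n
    p e : ℕ
    p = n P′ k
    e = n ^ k
    p≤e : n * p ≤ n * e
    p≤e = *-monoʳ-≤ n (nP′k≤n^k n k)
    lemma₁ : ∀ n a k p e → n * ((a + k) * p + k * k * e) ≡ n * (a * p) + k * (n * p) + k * k * (n * e)
    lemma₁ = solve-∀
    lemma₂ : ∀ x k y → x + k * y + k * k * y + suc k * y ≡ x + suc k * suc k * y
    lemma₂ = solve-∀

  factorial-quotient : ∀ {x r} → x ≤ r → x ! * (x * x) + x * x < r →
                       ∃[ ρ ] r ^ x ≡ (r C x) * x ! + ρ × ρ < r C x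
  factorial-quotient {x} {r} x≤r bound =
    e ∸ p , e≡cF+ρ , +-cancelˡ-< (c * F) _ c (subst (_< c * F + c) e≡cF+ρ e<cF+c)
    where
    instance
      r≢0 : NonZero r
      r≢0 = >-nonZero (≤-trans (s≤s z≤n) bound)
      e≢0 : NonZero (r ^ x)
      e≢0 = m^n≢0 r x
    F s e p c : ℕ
    F = x !
    s = x * x
    e = r ^ x
    p = r P′ x
    c = r C x
    cF≡p : c * F ≡ p
    cF≡p = nCk*k!≡nP′k x≤r
    e≡cF+ρ : e ≡ c * F + (e ∸ p)
    e≡cF+ρ = trans (sym (m+[n∸m]≡n (nP′k≤n^k r x))) (cong (_+ (e ∸ p)) (sym cF≡p))
    deficit : r * e ≤ r * p + s * e
    deficit = n*n^k≤n*nP′k+k*k*n^k x x≤r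
    se<rc : s * e < r * c
    se<rc = *-cancelˡ-< F _ _ (+-cancelʳ-< (s * e) _ _ (begin-strict
      F * (s * e) + s * e  ≡⟨ lemma₁ F s e ⟩
      (F * s + s) * e      <⟨ *-monoˡ-< e bound ⟩
      r * e                ≤⟨ deficit ⟩
      r * p + s * e        ≡⟨ cong (λ y → r * y + s * e) cF≡p ⟨
      r * (c * F) + s * e  ≡⟨ cong (_+ s * e) (lemma₂ r c F) ⟩
      F * (r * c) + s * e  ∎))
      where
      open ≤-Reasoning
      lemma₁ : ∀ F s e → F * (s * e) + s * e ≡ (F * s + s) * e
      lemma₁ = solve-∀
      lemma₂ : ∀ r c F → r * (c * F) ≡ F * (r * c)
      lemma₂ = solve-∀
    e<cF+c : e < c * F + c
    e<cF+c = *-cancelˡ-< r _ _ (begin-strict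
      r * e                ≤⟨ deficit ⟩
      r * p + s * e        <⟨ +-monoʳ-< (r * p) se<rc ⟩
      r * p + r * c        ≡⟨ cong (λ y → r * y + r * c) cF≡p ⟨
      r * (c * F) + r * c  ≡⟨ *-distribˡ-+ r (c * F) c ⟨
      r * (c * F + c)      ∎)
      where open ≤-Reasoning

  factorial-unique : ∀ {x r q ρ} → x ≤ r → x ! * (x * x) + x * x < r →
                     r ^ x ≡ (r C x) * q + ρ → ρ < r C x → q ≡ x !
  factorial-unique x≤r bound division ρ<c with factorial-quotient x≤r bound
  ... | ρ′ , division′ , ρ′<c = proj₁ (divMod-unique ρ<c ρ′<c (trans (sym division) division′))

  n<2^n : ∀ n → n < 2 ^ n
  n<2^n zero    = s≤s z≤n
  n<2^n (suc n) = ≤-<-trans (n<2^n n) (^-monoʳ-< 2 (s≤s (s≤s z≤n)) (n<1+n n))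

  nCk≤2^n : ∀ n k → n C k ≤ 2 ^ n
  nCk≤2^n zero    zero    = ≤-refl
  nCk≤2^n zero    (suc k) = z≤n
  nCk≤2^n (suc n) zero    = m^n>0 2 (suc n)
  nCk≤2^n (suc n) (suc k) = begin
    suc n C suc k      ≡⟨ nCk+nC[k+1]≡[n+1]C[k+1] n k ⟨
    n C k + n C suc k  ≤⟨ +-mono-≤ (nCk≤2^n n k) (nCk≤2^n n (suc k)) ⟩
    2 ^ n + 2 ^ n      ≡⟨ cong (2 ^ n +_) (+-identityʳ (2 ^ n)) ⟨
    2 ^ suc n          ∎
    where open ≤-Reasoning

  n!≤n^n : ∀ n → n ! ≤ n ^ n
  n!≤n^n zero    = ≤-refl
  n!≤n^n (suc n) = *-monoʳ-≤ (suc n) (≤-trans (n!≤n^n n) (^-monoˡ-≤ n (n≤1+n n)))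

  n!≤2^[n*n] : ∀ n → n ! ≤ 2 ^ (n * n)
  n!≤2^[n*n] n = begin
    n !          ≤⟨ n!≤n^n n ⟩
    n ^ n        ≤⟨ ^-monoˡ-≤ n (<⇒≤ (n<2^n n)) ⟩
    (2 ^ n) ^ n  ≡⟨ ^-*-assoc 2 n n ⟩
    2 ^ (n * n)  ∎
    where open ≤-Reasoning

  2^[3n]≡ : ∀ n → 2 ^ (3 * n) ≡ 2 ^ n * 2 ^ n * 2 ^ n
  2^[3n]≡ n = begin
    2 ^ (3 * n)            ≡⟨ cong (2 ^_) (lemma n) ⟩
    2 ^ (n + n + n)        ≡⟨ ^-distribˡ-+-* 2 (n + n) n ⟩
    2 ^ (n + n) * 2 ^ n    ≡⟨ cong (_* 2 ^ n) (^-distribˡ-+-* 2 n n) ⟩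
    2 ^ n * 2 ^ n * 2 ^ n  ∎
    where
    open ≡-Reasoning
    lemma : ∀ n → 3 * n ≡ n + n + n
    lemma = solve-∀

  2^[3n³]≡ : ∀ n → 2 ^ (3 * (n * (n * n))) ≡ (2 ^ (3 * (n * n))) ^ n
  2^[3n³]≡ n = trans (cong (2 ^_) (lemma n)) (sym (^-*-assoc 2 (3 * (n * n)) n))
    where
    lemma : ∀ n → 3 * (n * (n * n)) ≡ 3 * (n * n) * n
    lemma = solve-∀

  factorial-bound : ∀ x → x ! * (x * x) + x * x < 2 ^ (3 * (x * x))
  factorial-bound zero      = s≤s z≤n
  factorial-bound x@(suc _) = begin-strict
    x ! * s + s    ≡⟨ +-comm (x ! * s) s ⟩
    suc (x !) * s  ≤⟨ *-monoˡ-≤ s (s≤s (n!≤2^[n*n] x)) ⟩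
    suc t * s      <⟨ *-monoʳ-< (suc t) (n<2^n s) ⟩
    suc t * t      ≤⟨ *-monoˡ-≤ t (m<m*n t t {{m^n≢0 2 s}} 1<t) ⟩
    t * t * t      ≡⟨ 2^[3n]≡ s ⟨
    2 ^ (3 * s)    ∎
    where
    open ≤-Reasoning
    s t : ℕ
    s = x * x
    t = 2 ^ s
    1<t : 1 < t
    1<t = ^-monoʳ-≤ 2 {1} (≤-trans (s≤s z≤n) (m≤m*n x x))

  n≤2^[3n²] : ∀ n → n ≤ 2 ^ (3 * (n * n))
  n≤2^[3n²] zero      = z≤n
  n≤2^[3n²] n@(suc _) = begin
    n                      ≤⟨ m≤m*n n n ⟩
    n * n                  ≤⟨ m≤n+m (n * n) (n ! * (n * n)) ⟩
    n ! * (n * n) + n * n  <⟨ factorial-bound n ⟩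
    2 ^ (3 * (n * n))      ∎
    where open ≤-Reasoning

  2*nCk<2^[2n+4] : ∀ n k → 2 * (n C k) < 2 ^ (2 * n + 4)
  2*nCk<2^[2n+4] n k = begin-strict
    2 * (n C k)      ≤⟨ *-monoʳ-≤ 2 (nCk≤2^n n k) ⟩
    2 ^ suc n        <⟨ ^-monoʳ-< 2 (s≤s (s≤s z≤n)) 1+n<2n+4 ⟩
    2 ^ (2 * n + 4)  ∎
    where
    open ≤-Reasoning
    1+n<2n+4 : suc n < 2 * n + 4
    1+n<2n+4 = ≤-trans (m≤m+n (2 + n) (n + 2)) (≤-reflexive (lemma n))
      where
      lemma : ∀ n → 2 + n + (n + 2) ≡ 2 * n + 4
      lemma = solve-∀

  1+v≤v^[2+a] : ∀ {v} a → 1 < v → suc v ≤ v ^ (2 + a)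
  1+v≤v^[2+a] {v} a 1<v = begin
    suc v            ≤⟨ m<m*n v v 1<v ⟩
    v * v            ≤⟨ *-monoʳ-≤ v (m≤m*n v (v ^ a) {{m^n≢0 v a}}) ⟩
    v * (v * v ^ a)  ∎
    where
    open ≤-Reasoning
    instance _ = >-nonZero (<-trans (s≤s z≤n) 1<v)

  -- The exponents z₁ and z₂ prescribed by B.
  P₁ : ℕ → ℕ → ℕ
  P₁ a b = 2 * a * a * a + 8 * a * a + 2 * a * b + 12 * a + 4 * b + 8

  P₂ : ℕ → ℕ
  P₂ a = 2 * a * a + 8 * a + 8

  2^P₂≡ : ∀ a → 2 ^ P₂ a ≡ (2 ^ (2 * a + 4)) ^ (2 + a)
  2^P₂≡ a = trans (cong (2 ^_) (lemma a)) (sym (^-*-assoc 2 (2 * a + 4) (2 + a)))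
    where
    lemma : ∀ a → 2 * a * a + 8 * a + 8 ≡ (2 * a + 4) * (2 + a)
    lemma = solve-∀

  2^P₁≡ : ∀ a b → 2 ^ P₁ a b ≡ (2 ^ P₂ a) ^ a * (2 ^ (2 * a + 4)) ^ (2 + b)
  2^P₁≡ a b = begin
    2 ^ P₁ a b
      ≡⟨ cong (2 ^_) (lemma a b) ⟩
    2 ^ (P₂ a * a + (2 * a + 4) * (2 + b))
      ≡⟨ ^-distribˡ-+-* 2 (P₂ a * a) _ ⟩
    2 ^ (P₂ a * a) * 2 ^ ((2 * a + 4) * (2 + b))
      ≡⟨ cong₂ _*_ (^-*-assoc 2 (P₂ a) a) (^-*-assoc 2 (2 * a + 4) (2 + b)) ⟨
    (2 ^ P₂ a) ^ a * (2 ^ (2 * a + 4)) ^ (2 + b) ∎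
    where
    open ≡-Reasoning
    lemma : ∀ a b → 2 * a * a * a + 8 * a * a + 2 * a * b + 12 * a + 4 * b + 8
                    ≡ (2 * a * a + 8 * a + 8) * a + (2 * a + 4) * (2 + b)
    lemma = solve-∀

open ℕ-Arithmetic

open import Defs
open import Data.Integer using (ℤ; +_; -[1+_]; +0; +[1+_]; 0ℤ; 1ℤ; _+_; _-_; _*_; _≤_; +≤+)
open import Data.Integer.Properties
  using (pos-*; +-injective; +-inverseʳ; i-j≡0⇒i≡j; i*j≡0⇒i≡0∨j≡0; +-mono-≤)
open import Data.Integer.Tactic.RingSolver using (solve-∀)
open import Data.Nat using (ℕ; _!)
import Data.Nat as ℕ
import Data.Nat.Properties as ℕ
open import Data.Nat.Combinatorics using (_C_)
open import Data.Product using (Σ; ∃-syntax; _×_; _,_)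
open import Data.Sum using ([_,_]′)
open import Function.Base using (id; _∘_)
open import Function.Bundles using (_⇔_; mk⇔; Equivalence)
open import Relation.Binary.PropositionalEquality
  using (_≡_; refl; sym; trans; cong; cong₂; module ≡-Reasoning)

-- The polynomials of B verbatim, so that sq (+ z₁ - P₁ℤ (+ a) (+ b)) is B's first summand.
P₁ℤ : ℤ → ℤ → ℤ
P₁ℤ a b = + 2 * a * a * a + + 8 * a * a + + 2 * a * b + + 12 * a + + 4 * b + + 8

P₂ℤ : ℤ → ℤ
P₂ℤ a = + 2 * a * a + + 8 * a + + 8

pos-P₁ : ∀ a b → + P₁ a b ≡ P₁ℤ (+ a) (+ b)
pos-P₁ a b
  rewrite sym (pos-* 2 a) | sym (pos-* (2 ℕ.* a) a) | sym (pos-* (2 ℕ.* a ℕ.* a) a)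
        | sym (pos-* 8 a) | sym (pos-* (8 ℕ.* a) a) | sym (pos-* (2 ℕ.* a) b)
        | sym (pos-* 12 a) | sym (pos-* 4 b) = refl

pos-P₂ : ∀ a → + P₂ a ≡ P₂ℤ (+ a)
pos-P₂ a rewrite sym (pos-* 2 a) | sym (pos-* (2 ℕ.* a) a) | sym (pos-* 8 a) = refl

sq-nonNeg : ∀ i → 0ℤ ≤ sq i
sq-nonNeg +0       = +≤+ ℕ.z≤n
sq-nonNeg +[1+ n ] = +≤+ ℕ.z≤n
sq-nonNeg -[1+ n ] = +≤+ ℕ.z≤n

E/-nonNeg : ∀ a b c d e → 0ℤ ≤ E/ a b c d e
E/-nonNeg a b c d e = +-mono-≤ (sq-nonNeg (a - b * e - c)) (sq-nonNeg (c + d + 1ℤ - b))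

B-nonNeg : ∀ a b z₁ z₂ z₃ z₄ z₅ z₆ z₇ c → 0ℤ ≤ B a b z₁ z₂ z₃ z₄ z₅ z₆ z₇ c
B-nonNeg a b z₁ z₂ z₃ z₄ z₅ z₆ z₇ c =
  +-mono-≤ (+-mono-≤ (+-mono-≤ (sq-nonNeg (+ z₁ - P₁ℤ (+ a) (+ b))) (sq-nonNeg (+ z₂ - P₂ℤ (+ a))))
                     (E/-nonNeg (pow2 z₁) (pow2 z₂ - pow2 (2 ℕ.* a ℕ.+ 4) - 1ℤ) (+ z₄) (+ z₅) (+ z₃)))
           (E/-nonNeg (+ z₃) (pow2 (2 ℕ.* a ℕ.+ 4)) (+ c) (+ z₇) (+ z₆))

nonNeg-+≡0 : ∀ {i j} → 0ℤ ≤ i → 0ℤ ≤ j → i + j ≡ 0ℤ → i ≡ 0ℤ × j ≡ 0ℤ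
nonNeg-+≡0 (+≤+ {n = m} _) (+≤+ _) m+n≡0 =
  cong +_ (ℕ.m+n≡0⇒m≡0 m (+-injective m+n≡0)) , cong +_ (ℕ.m+n≡0⇒n≡0 m (+-injective m+n≡0))

nonNeg-+₄≡0 : ∀ {i j k l} → 0ℤ ≤ i → 0ℤ ≤ j → 0ℤ ≤ k → 0ℤ ≤ l → i + j + k + l ≡ 0ℤ →
              i ≡ 0ℤ × j ≡ 0ℤ × k ≡ 0ℤ × l ≡ 0ℤ
nonNeg-+₄≡0 i≥0 j≥0 k≥0 l≥0 h with nonNeg-+≡0 (+-mono-≤ (+-mono-≤ i≥0 j≥0) k≥0) l≥0 h
... | i+j+k≡0 , l≡0 with nonNeg-+≡0 (+-mono-≤ i≥0 j≥0) k≥0 i+j+k≡0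
... | i+j≡0 , k≡0 with nonNeg-+≡0 i≥0 j≥0 i+j≡0
... | i≡0 , j≡0 = i≡0 , j≡0 , k≡0 , l≡0

sq≡0⇒≡0 : ∀ {i} → sq i ≡ 0ℤ → i ≡ 0ℤ
sq≡0⇒≡0 {i} i*i≡0 = [ id , id ]′ (i*j≡0⇒i≡0∨j≡0 i i*i≡0)

sq[+m-i]≡0⇒m≡n : ∀ {m n i} → + n ≡ i → sq (+ m - i) ≡ 0ℤ → m ≡ n
sq[+m-i]≡0⇒m≡n {m} {i = i} refl = +-injective ∘ i-j≡0⇒i≡j (+ m) i ∘ sq≡0⇒≡0

sq[+n-i]≡0 : ∀ {n i} → + n ≡ i → sq (+ n - i) ≡ 0ℤ
sq[+n-i]≡0 {n} refl = cong sq (+-inverseʳ (+ n))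

E/≡0⇔ : ∀ a b c d e → E/ a b c d e ≡ 0ℤ ⇔ (a ≡ b * e + c × b ≡ c + d + 1ℤ)
E/≡0⇔ a b c d e = mk⇔ to from
  where
  to : E/ a b c d e ≡ 0ℤ → a ≡ b * e + c × b ≡ c + d + 1ℤ
  to h with nonNeg-+≡0 (sq-nonNeg (a - b * e - c)) (sq-nonNeg (c + d + 1ℤ - b)) h
  ... | quotient , divisor =
    i-j≡0⇒i≡j a (b * e + c) (trans (lemma a (b * e) c) (sq≡0⇒≡0 quotient)) ,
    sym (i-j≡0⇒i≡j (c + d + 1ℤ) b (sq≡0⇒≡0 divisor))
    where
    lemma : ∀ a x c → a - (x + c) ≡ a - x - c
    lemma = solve-∀
  from : a ≡ b * e + c × b ≡ c + d + 1ℤ → E/ a b c d e ≡ 0ℤ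
  from (refl , refl) = cong₂ (λ x y → sq x + sq y) (lemma (b * e) c) (+-inverseʳ (c + d + 1ℤ))
    where
    lemma : ∀ x c → x + c - x - c ≡ 0ℤ
    lemma = solve-∀

E/≡0⇒divMod : ∀ {n} b {r s q} → E/ (+ n) b (+ r) (+ s) (+ q) ≡ 0ℤ →
              ∃[ d ] b ≡ + d × n ≡ d ℕ.* q ℕ.+ r × r ℕ.< d
E/≡0⇒divMod {n} b {r} {s} {q} h with Equivalence.to (E/≡0⇔ (+ n) b (+ r) (+ s) (+ q)) h
... | quotient , refl = r ℕ.+ s ℕ.+ 1 , refl ,
  +-injective (trans quotient (cong (_+ + r) (sym (pos-* (r ℕ.+ s ℕ.+ 1) q)))) ,
  ℕ.≤-trans (ℕ.s≤s (ℕ.m≤m+n r s)) (ℕ.≤-reflexive (ℕ.+-comm 1 (r ℕ.+ s)))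

divMod⇒E/≡0 : ∀ {n b d q r} → b ≡ + d → n ≡ d ℕ.* q ℕ.+ r → r ℕ.< d →
              E/ (+ n) b (+ r) (+ (d ℕ.∸ ℕ.suc r)) (+ q) ≡ 0ℤ
divMod⇒E/≡0 {n} {b} {d} {q} {r} refl refl r<d =
  Equivalence.from (E/≡0⇔ (+ n) (+ d) (+ r) (+ (d ℕ.∸ ℕ.suc r)) (+ q))
    (cong (_+ + r) (pos-* d q) ,
     cong +_ (sym (trans (ℕ.+-comm (r ℕ.+ (d ℕ.∸ ℕ.suc r)) 1) (ℕ.m+[n∸m]≡n r<d))))

pow2-divisor⇔ : ∀ m w D → pow2 m - pow2 w - 1ℤ ≡ + D ⇔ 2 ℕ.^ m ≡ D ℕ.+ ℕ.suc (2 ℕ.^ w)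
pow2-divisor⇔ m w D = mk⇔
  (λ eq → +-injective (trans (lemma₁ (pow2 m) (pow2 w)) (cong (_+ (1ℤ + pow2 w)) eq)))
  (λ eq → trans (cong (λ k → + k - pow2 w - 1ℤ) eq) (lemma₂ (+ D) (pow2 w)))
  where
  lemma₁ : ∀ i j → i ≡ i - j - 1ℤ + (1ℤ + j)
  lemma₁ = solve-∀
  lemma₂ : ∀ k j → k + (1ℤ + j) - j - 1ℤ ≡ k
  lemma₂ = solve-∀

module _ {a b : ℕ} (b≤a : b ℕ.≤ a) where

  private
    v D : ℕ
    v = 2 ℕ.^ (2 ℕ.* a ℕ.+ 4)
    D = v ℕ.^ (2 ℕ.+ a) ℕ.∸ ℕ.suc v
    digits : ∀ j → 2 ℕ.* (a C j) ℕ.< v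
    digits = 2*nCk<2^[2n+4] a
    2^P₂≡D+1+v : 2 ℕ.^ P₂ a ≡ D ℕ.+ ℕ.suc v
    2^P₂≡D+1+v = trans (2^P₂≡ a) (sym (ℕ.m∸n+n≡m (1+v≤v^[2+a] a (ℕ.<⇒≤ (digits 0)))))

  B≡0⇒c≡aCb : ∀ {z₁ z₂ z₃ z₄ z₅ z₆ z₇ c} → B a b z₁ z₂ z₃ z₄ z₅ z₆ z₇ c ≡ 0ℤ → c ≡ a C b
  B≡0⇒c≡aCb {z₁} {z₂} {z₃} {z₄} {z₅} {z₆} {z₇} {c} h
    with nonNeg-+₄≡0 (sq-nonNeg (+ z₁ - P₁ℤ (+ a) (+ b))) (sq-nonNeg (+ z₂ - P₂ℤ (+ a)))
                     (E/-nonNeg (pow2 z₁) (pow2 z₂ - + v - 1ℤ) (+ z₄) (+ z₅) (+ z₃))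
                     (E/-nonNeg (+ z₃) (+ v) (+ c) (+ z₇) (+ z₆)) h
  ... | h₁ , h₂ , h₃ , h₄ with E/≡0⇒divMod (pow2 z₂ - + v - 1ℤ) h₃ | E/≡0⇒divMod (+ v) h₄
  ... | d , divisor , division , z₄<d | _ , refl , z₃≡vz₆+c , c<v =
    binomial-digit-unique b≤a digits d+1+v≡v^[2+a] division′ z₄<d c<v
    where
    open ≡-Reasoning
    z₁≡P₁ : z₁ ≡ P₁ a b
    z₁≡P₁ = sq[+m-i]≡0⇒m≡n (pos-P₁ a b) h₁
    z₂≡P₂ : z₂ ≡ P₂ a
    z₂≡P₂ = sq[+m-i]≡0⇒m≡n (pos-P₂ a) h₂
    d+1+v≡2^P₂ : d ℕ.+ ℕ.suc v ≡ 2 ℕ.^ P₂ a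
    d+1+v≡2^P₂ = trans (sym (Equivalence.to (pow2-divisor⇔ z₂ (2 ℕ.* a ℕ.+ 4) d) divisor))
                       (cong (2 ℕ.^_) z₂≡P₂)
    d+1+v≡v^[2+a] : d ℕ.+ ℕ.suc v ≡ v ℕ.^ (2 ℕ.+ a)
    d+1+v≡v^[2+a] = trans d+1+v≡2^P₂ (2^P₂≡ a)
    division′ : (d ℕ.+ ℕ.suc v) ℕ.^ a ℕ.* v ℕ.^ (2 ℕ.+ b) ≡ d ℕ.* (v ℕ.* z₆ ℕ.+ c) ℕ.+ z₄
    division′ = begin
      (d ℕ.+ ℕ.suc v) ℕ.^ a ℕ.* v ℕ.^ (2 ℕ.+ b)  ≡⟨ cong (λ x → x ℕ.^ a ℕ.* v ℕ.^ (2 ℕ.+ b)) d+1+v≡2^P₂ ⟩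
      (2 ℕ.^ P₂ a) ℕ.^ a ℕ.* v ℕ.^ (2 ℕ.+ b)     ≡⟨ 2^P₁≡ a b ⟨
      2 ℕ.^ P₁ a b                               ≡⟨ cong (2 ℕ.^_) z₁≡P₁ ⟨
      2 ℕ.^ z₁                                   ≡⟨ division ⟩
      d ℕ.* z₃ ℕ.+ z₄                            ≡⟨ cong (λ q → d ℕ.* q ℕ.+ z₄) z₃≡vz₆+c ⟩
      d ℕ.* (v ℕ.* z₆ ℕ.+ c) ℕ.+ z₄              ∎

  B-solution : ∃[ z₁ ] ∃[ z₂ ] ∃[ z₃ ] ∃[ z₄ ] ∃[ z₅ ] ∃[ z₆ ] ∃[ z₇ ]
                 B a b z₁ z₂ z₃ z₄ z₅ z₆ z₇ (a C b) ≡ 0ℤ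
  B-solution with binomial-digit b≤a digits (trans (sym 2^P₂≡D+1+v) (2^P₂≡ a))
  ... | q , r , division , r<D =
    P₁ a b , P₂ a , v ℕ.* q ℕ.+ a C b , r , D ℕ.∸ ℕ.suc r , q , v ℕ.∸ ℕ.suc (a C b) ,
    cong₂ _+_ (cong₂ _+_ (cong₂ _+_ (sq[+n-i]≡0 (pos-P₁ a b)) (sq[+n-i]≡0 (pos-P₂ a)))
                         (divMod⇒E/≡0 divisor division′ r<D))
              (divMod⇒E/≡0 refl refl (ℕ.≤-<-trans (ℕ.m≤m+n (a C b) (a C b ℕ.+ 0)) (digits b)))
    where
    open ≡-Reasoning
    divisor : pow2 (P₂ a) - + v - 1ℤ ≡ + D
    divisor = Equivalence.from (pow2-divisor⇔ (P₂ a) (2 ℕ.* a ℕ.+ 4) D) 2^P₂≡D+1+v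
    division′ : 2 ℕ.^ P₁ a b ≡ D ℕ.* (v ℕ.* q ℕ.+ a C b) ℕ.+ r
    division′ = begin
      2 ℕ.^ P₁ a b                               ≡⟨ 2^P₁≡ a b ⟩
      (2 ℕ.^ P₂ a) ℕ.^ a ℕ.* v ℕ.^ (2 ℕ.+ b)     ≡⟨ cong (λ x → x ℕ.^ a ℕ.* v ℕ.^ (2 ℕ.+ b)) 2^P₂≡D+1+v ⟩
      (D ℕ.+ ℕ.suc v) ℕ.^ a ℕ.* v ℕ.^ (2 ℕ.+ b)  ≡⟨ division ⟩
      D ℕ.* (v ℕ.* q ℕ.+ a C b) ℕ.+ r            ∎

solution⇒x₂≡x! : ∀ {x x₂ y₁ y₂ y₃ y₄ z₁ z₂ z₃ z₄ z₅ z₆ z₇ y₁₂ y₁₃} →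
                 y₁ ≡ x ℕ.* x → y₂ ≡ 2 ℕ.^ (3 ℕ.* y₁) → y₃ ≡ x ℕ.* y₁ →
                 B y₂ x z₁ z₂ z₃ z₄ z₅ z₆ z₇ y₄ ≡ 0ℤ →
                 E/ (pow2 (3 ℕ.* y₃)) (+ y₄) (+ y₁₂) (+ y₁₃) (+ x₂) ≡ 0ℤ →
                 x₂ ≡ x !
solution⇒x₂≡x! {x} {y₄ = y₄} refl refl refl hB hE
  with B≡0⇒c≡aCb (n≤2^[3n²] x) hB | E/≡0⇒divMod (+ y₄) hE
... | refl | _ , refl , division , y₁₂<c =
  factorial-unique (n≤2^[3n²] x) (factorial-bound x) (trans (sym (2^[3n³]≡ x)) division) y₁₂<c

mainTheorem11 : (x₁ x₂ : ℕ) →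
    (x₂ ≡ x₁ !) ⇔
    (Σ ℕ λ y₁ → Σ ℕ λ y₂ → Σ ℕ λ y₃ → Σ ℕ λ y₄ → Σ ℕ λ y₅ → Σ ℕ λ y₆ → Σ ℕ λ y₇ →
     Σ ℕ λ y₈ → Σ ℕ λ y₉ → Σ ℕ λ y₁₀ → Σ ℕ λ y₁₁ → Σ ℕ λ y₁₂ → Σ ℕ λ y₁₃ →
       sq (+ y₁ - + x₁ * + x₁) + sq (+ y₂ - pow2 (3 Data.Nat.* y₁)) + sq (+ y₃ - + x₁ * + y₁)
       + B y₂ x₁ y₅ y₆ y₇ y₈ y₉ y₁₀ y₁₁ y₄
       + E/ (pow2 (3 Data.Nat.* y₃)) (+ y₄) (+ y₁₂) (+ y₁₃) (+ x₂)
       ≡ + 0)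
mainTheorem11 x x₂ = mk⇔
  (λ { refl →
    let z₁ , z₂ , z₃ , z₄ , z₅ , z₆ , z₇ , B≡0 = B-solution x≤r
        ρ , division , ρ<c = factorial-quotient x≤r (factorial-bound x)
    in x ℕ.* x , r , x ℕ.* (x ℕ.* x) , r C x , z₁ , z₂ , z₃ , z₄ , z₅ , z₆ , z₇ , ρ , r C x ℕ.∸ ℕ.suc ρ ,
       cong₂ _+_ (cong₂ _+_ (cong₂ _+_ (cong₂ _+_ (sq[+n-i]≡0 (pos-* x x)) (sq[+n-i]≡0 {r} refl))
                                       (sq[+n-i]≡0 (pos-* x (x ℕ.* x))))
                            B≡0)
                 (divMod⇒E/≡0 refl (trans (2^[3n³]≡ x) division) ρ<c) })
  (λ (y₁ , y₂ , y₃ , y₄ , z₁ , z₂ , z₃ , z₄ , z₅ , z₆ , z₇ , y₁₂ , y₁₃ , h) →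
    let sq₁≥0 = sq-nonNeg (+ y₁ - + x * + x)
        sq₂≥0 = sq-nonNeg (+ y₂ - pow2 (3 ℕ.* y₁))
        h₁₂ , h₃ , hB , hE = nonNeg-+₄≡0 (+-mono-≤ sq₁≥0 sq₂≥0) (sq-nonNeg (+ y₃ - + x * + y₁))
                               (B-nonNeg y₂ x z₁ z₂ z₃ z₄ z₅ z₆ z₇ y₄)
                               (E/-nonNeg (pow2 (3 ℕ.* y₃)) (+ y₄) (+ y₁₂) (+ y₁₃) (+ x₂)) h
        h₁ , h₂ = nonNeg-+≡0 sq₁≥0 sq₂≥0 h₁₂
    in solution⇒x₂≡x! (sq[+m-i]≡0⇒m≡n (pos-* x x) h₁) (sq[+m-i]≡0⇒m≡n refl h₂)
                      (sq[+m-i]≡0⇒m≡n (pos-* x y₁) h₃) hB hE)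
  where
  r : ℕ
  r = 2 ℕ.^ (3 ℕ.* (x ℕ.* x))
  x≤r : x ℕ.≤ r
  x≤r = n≤2^[3n²] x
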